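{- Let $q$ be a prime power and let $\mathcal W(5,q)$ be the symplectic polar space of ${\rm PG}(5,q)$ defined by the alternating form with Gram matrix $\begin{pmatrix}0_3 & I_3\\ -I_3 & 0_3\end{pmatrix}$, with polarity $\perp$. Let $\Pi_1=\langle U_4,U_5,U_6\rangle$, $\Pi_2=\langle U_1,U_2,U_3\rangle$. For each point $P\in\Pi_2$ choose a $3$-space $\Sigma_P\subseteq P^\perp$ with $P\notin \Sigma_P$, let $\mathcal W_P$ be the induced non-degenerate symplectic polar space on $\Sigma_P$, $r_P=\Sigma_P\cap\Pi_1$, $t_P=\Sigma_P\cap\Pi_2$, choose a line-spread $\mathcal F_P$ of $\mathcal W_P$ containing $r_P,t_P$, and let $\mathcal X_P=\{\langle P,\ell\rangle:\ell\in\mathcal F_P\setminus\{r_P,t_P\}\}$; put $\mathcal X=\bigcup_{P\in\Pi_2}\mathcal X_P\cup\{\Pi_2\}$. Let $\sigma\notin\mathcal X$ be a plane of $\mathcal W(5,q)$ disjoint from $\Pi_1$ and meeting $\Pi_2$ in at least one point. Then there exists a plane of $\mathcal X$ meeting $\sigma$ in a line.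
   Context: $U_i$ is the point with $1$ in position $i$ and $0$ elsewhere. A line-spread of $\mathcal W_P$ is a set of pairwise disjoint totally isotropic lines of $\mathcal W_P$ partitioning the points of $\Sigma_P$. -}

module Defs where

open import Level using (0ℓ)
open import Data.Nat using (ℕ; zero; suc)
open import Data.Fin using (Fin; zero; suc; #_; toℕ)
import Data.Nat as ℕ
open import Data.Product using (Σ; ∃; _×_; _,_)
open import Data.Sum using (_⊎_)
open import Data.List using (List; length; lookup)
open import Data.List.Membership.Propositional using (_∈_)
open import Data.List.Relation.Unary.Any using (Any)
open import Relation.Nullary using (¬_)
open import Relation.Binary.PropositionalEquality using (_≡_)
open import Relation.Binary.Definitions using (DecidableEquality)
open import Algebra.Core using (Op₁; Op₂)
open import Algebra.Structures using (IsCommutativeRing)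

-- Every finite field has
-- prime-power order q, and GF(q) exists for every prime power q, so
-- quantifying over finite fields = quantifying over GF(q), q a prime power.
record FiniteField : Set₁ where
  infixl 6 _+_
  infixl 7 _*_
  infix  8 -_
  field
    Carrier  : Set
    _+_ _*_  : Op₂ Carrier
    -_       : Op₁ Carrier
    0# 1#    : Carrier
    isCommutativeRing : IsCommutativeRing _≡_ _+_ _*_ -_ 0# 1#
    0≢1      : ¬ (0# ≡ 1#)
    inverse  : ∀ x → ¬ (x ≡ 0#) → ∃ λ y → x * y ≡ 1#
    _≟_      : DecidableEquality Carrier
    elements : List Carrier
    complete : ∀ x → x ∈ elements

module Geometry (𝔽 : FiniteField) where
  open FiniteField 𝔽

  -- vectors of F^6 ; coordinate k (0-based) corresponds to U_{k+1}
  V6 : Set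
  V6 = Fin 6 → Carrier

  sumF : ∀ {n} → (Fin n → Carrier) → Carrier
  sumF {zero}  f = 0#
  sumF {suc n} f = f zero + sumF (λ i → f (suc i))

  _-ᶠ_ : Carrier → Carrier → Carrier
  a -ᶠ b = a + (- b)

  B : V6 → V6 → Carrier
  B u v = (u (# 0) * v (# 3) + u (# 1) * v (# 4) + u (# 2) * v (# 5))
          -ᶠ (u (# 3) * v (# 0) + u (# 4) * v (# 1) + u (# 5) * v (# 2))

  IsZero : V6 → Set
  IsZero v = ∀ k → v k ≡ 0#

  -- a family of n vectors (spanning a projective (n-1)-space when independent)
  Fam : ℕ → Set
  Fam n = Fin n → V6

  InSpan : ∀ {n} → Fam n → V6 → Set
  InSpan {n} b v = Σ (Fin n → Carrier) λ c → ∀ k → v k ≡ sumF (λ i → c i * b i k)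

  LinIndep : ∀ {n} → Fam n → Set
  LinIndep {n} b = ∀ (c : Fin n → Carrier) →
    (∀ k → sumF (λ i → c i * b i k) ≡ 0#) → ∀ i → c i ≡ 0#

  SameSpace : ∀ {m n} → Fam m → Fam n → Set
  SameSpace a b = ∀ v → (InSpan a v → InSpan b v) × (InSpan b v → InSpan a v)

  IsMeet : ∀ {k m n} → Fam k → Fam m → Fam n → Set
  IsMeet l a b = ∀ v → (InSpan l v → InSpan a v × InSpan b v)
                     × (InSpan a v × InSpan b v → InSpan l v)

  TotIso : ∀ {n} → Fam n → Set
  TotIso b = ∀ i j → B (b i) (b j) ≡ 0#

  unit : Fin 6 → V6
  unit i k with toℕ i ℕ.≟ toℕ k
  ... | Relation.Nullary.yes _ = 1#
  ... | Relation.Nullary.no  _ = 0#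

  Π₁ : Fam 3
  Π₁ i = unit (3 Data.Fin.↑ʳ i)

  Π₂ : Fam 3
  Π₂ i = unit (i Data.Fin.↑ˡ 3)

  pair : V6 → V6 → Fam 2
  pair u w zero    = u
  pair u w (suc _) = w

  triple : V6 → V6 → V6 → Fam 3
  triple a b c zero          = a
  triple a b c (suc zero)    = b
  triple a b c (suc (suc _)) = c

  IsPlaneW : Fam 3 → Set
  IsPlaneW σ = LinIndep σ × TotIso σ

  -- canonical representative of a projective point: first nonzero coordinate is 1
  Normalized : V6 → Set
  Normalized p = ∃ λ i → p i ≡ 1# × (∀ j → toℕ j ℕ.< toℕ i → p j ≡ 0#)

  PointOfΠ₂ : V6 → Set
  PointOfΠ₂ p = Normalized p × InSpan Π₂ p

  IsLineSpread : Fam 4 → List (Fam 2) → Set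
  IsLineSpread S F =
      (∀ ℓ → ℓ ∈ F → LinIndep ℓ × (∀ i → InSpan S (ℓ i)) × TotIso ℓ)
    × (∀ (i j : Fin (length F)) → ¬ (i ≡ j) →
         ∀ v → InSpan (lookup F i) v → InSpan (lookup F j) v → IsZero v)
    × (∀ v → ¬ IsZero v → InSpan S v → Any (λ ℓ → InSpan ℓ v) F)

  ValidChoice : V6 → Fam 4 → List (Fam 2) → Set
  ValidChoice p S F =
      LinIndep S
    × (∀ i → B p (S i) ≡ 0#)
    × ¬ InSpan S p
    × IsLineSpread S F
    × Any (λ ℓ → IsMeet ℓ S Π₁) F
    × Any (λ ℓ → IsMeet ℓ S Π₂) F

  -- τ ∈ 𝒳  (planes compared as subspaces)
  InX : (V6 → Fam 4) → (V6 → List (Fam 2)) → Fam 3 → Set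
  InX Sg Sp τ =
      SameSpace τ Π₂
    ⊎ (∃ λ p → PointOfΠ₂ p × ∃ λ ℓ → ℓ ∈ Sp p
         × ¬ IsMeet ℓ (Sg p) Π₁ × ¬ IsMeet ℓ (Sg p) Π₂
         × SameSpace τ (triple p (ℓ zero) (ℓ (suc zero))))

  MeetInLine : Fam 3 → Fam 3 → Set
  MeetInLine σ τ = ∃ λ u → ∃ λ w → LinIndep (pair u w)
    × InSpan σ u × InSpan τ u × InSpan σ w × InSpan τ w
    × (∀ v → InSpan σ v → InSpan τ v → InSpan (pair u w) v)

-- Let P be the point σ ∩ Π₂, normalised. As σ is totally isotropic, σ ⊆ P^⊥, and P^⊥ = ⟨P⟩ ⊕ Σ_P by
-- a dimension count (7 vectors of 𝔽⁶ are dependent, and a vector u with B(P,u) ≠ 0 cannot take part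
-- in a dependence among vectors of P^⊥). Since σ ≠ Π₂, some vector of σ lies off Π₂; removing its
-- P-component gives a point m ∈ σ ∩ Σ_P off Π₂, and off Π₁ because σ ∩ Π₁ = 0. The line ℓ of the
-- spread F_P through m is therefore neither r_P nor t_P, so τ = ⟨P, ℓ⟩ ∈ 𝒳 and σ ∩ τ ⊇ ⟨P, m⟩.
-- A point of σ ∩ τ outside ⟨P, m⟩ would give three independent vectors spanning both σ and τ,
-- i.e. σ = τ ∈ 𝒳; as 𝔽 is finite, span membership is decidable, so σ ∩ τ = ⟨P, m⟩ constructively.
module Submission where

open import Defs
open import Data.Product using (∃; _×_)
open import Relation.Nullary using (¬_)
open import Data.List using (List)

open import Level using (0ℓ)
open import Data.Product using (_,_; proj₁; proj₂; swap)
open import Data.Sum using (_⊎_; inj₁; inj₂)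
open import Data.Empty using (⊥-elim)
open import Data.Nat using (zero; suc; s≤s)
import Data.Nat as ℕ
open import Data.Fin using (Fin; zero; suc; #_; toℕ; punchIn; punchOut)
import Data.Fin as Fin
import Data.Fin.Properties as FinP
open import Data.Vec.Functional using ([]; _∷_)
open import Data.List.Membership.Propositional using (find; lose)
open import Data.List.Relation.Unary.Any using (any?; satisfied)
open import Function using (_∘_; id)
open import Relation.Nullary using (Dec; yes; no; ¬?)
open import Relation.Nullary.Decidable using (map′; decidable-stable)
open import Relation.Binary.PropositionalEquality
open import Algebra.Bundles using (CommutativeRing)

module FieldProperties (𝔽 : FiniteField) where
  open FiniteField 𝔽
  open ≡-Reasoning

  commutativeRing : CommutativeRing 0ℓ 0ℓ
  commutativeRing = record { isCommutativeRing = isCommutativeRing }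

  open CommutativeRing commutativeRing public
    using ( +-comm; +-identityˡ; +-identityʳ; *-comm; *-assoc; *-identityˡ; *-identityʳ
          ; zeroˡ; zeroʳ; distribˡ; distribʳ; -‿inverseʳ; commutativeSemiring )
  open import Algebra.Properties.Ring (CommutativeRing.ring commutativeRing) public
    using (-‿distribˡ-*; -‿distribʳ-*)
  open import Algebra.Properties.AbelianGroup (CommutativeRing.+-abelianGroup commutativeRing) public
    using ( ε⁻¹≈ε; ⁻¹-involutive; ⁻¹-∙-comm; ⁻¹-anti-homo‿-; inverseˡ-unique; xyx⁻¹≈y
          ; //-rightDividesˡ )
  open import Algebra.Properties.CommutativeSemigroup
    (CommutativeRing.+-commutativeSemigroup commutativeRing) public
    using () renaming (interchange to +-interchange; x∙yz≈y∙xz to x+[y+z]≡y+[x+z])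

  1≢0 : 1# ≢ 0#
  1≢0 = 0≢1 ∘ sym

  inv : ∀ x → x ≢ 0# → Carrier
  inv x x≢0 = proj₁ (inverse x x≢0)

  inv-*ˡ : ∀ x (x≢0 : x ≢ 0#) → inv x x≢0 * x ≡ 1#
  inv-*ˡ x x≢0 = trans (*-comm _ x) (proj₂ (inverse x x≢0))

  x*y≡0⇒x≡0 : ∀ {x y} → y ≢ 0# → x * y ≡ 0# → x ≡ 0#
  x*y≡0⇒x≡0 {x} {y} y≢0 xy≡0 = begin
    x                   ≡⟨ *-identityʳ x ⟨
    x * 1#              ≡⟨ cong (x *_) (inv-*ˡ y y≢0) ⟨
    x * (inv y y≢0 * y) ≡⟨ cong (x *_) (*-comm _ y) ⟩
    x * (y * inv y y≢0) ≡⟨ *-assoc x y _ ⟨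
    x * y * inv y y≢0   ≡⟨ cong (_* inv y y≢0) xy≡0 ⟩
    0# * inv y y≢0      ≡⟨ zeroˡ _ ⟩
    0#                  ∎

  0*x+y≡y : ∀ x y → 0# * x + y ≡ y
  0*x+y≡y x y = trans (cong (_+ y) (zeroˡ x)) (+-identityˡ y)

  -x≡0⇒x≡0 : ∀ {x} → - x ≡ 0# → x ≡ 0#
  -x≡0⇒x≡0 {x} -x≡0 = trans (sym (⁻¹-involutive x)) (trans (cong -_ -x≡0) ε⁻¹≈ε)

  x≡y+z⇒x-y≡z : ∀ {x y z} → x ≡ y + z → x + - y ≡ z
  x≡y+z⇒x-y≡z {y = y} {z} refl = xyx⁻¹≈y y z

  x-y≡z⇒x≡y+z : ∀ {x y z} → x + - y ≡ z → x ≡ y + z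
  x-y≡z⇒x≡y+z {x} {y} refl = trans (sym (//-rightDividesˡ y x)) (+-comm _ y)

module Sums (𝔽 : FiniteField) where
  open FiniteField 𝔽
  open Geometry 𝔽 using (sumF)
  open FieldProperties 𝔽
  open ≡-Reasoning

  sumF-cong : ∀ {n} {f g : Fin n → Carrier} → (∀ i → f i ≡ g i) → sumF f ≡ sumF g
  sumF-cong {zero}  f≡g = refl
  sumF-cong {suc n} f≡g = cong₂ _+_ (f≡g zero) (sumF-cong (f≡g ∘ suc))

  sumF-zero : ∀ {n} {f : Fin n → Carrier} → (∀ i → f i ≡ 0#) → sumF f ≡ 0#
  sumF-zero {zero}  f≡0 = refl
  sumF-zero {suc n} f≡0 = trans (cong₂ _+_ (f≡0 zero) (sumF-zero (f≡0 ∘ suc))) (+-identityˡ 0#)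

  sumF-+ : ∀ {n} (f g : Fin n → Carrier) → sumF (λ i → f i + g i) ≡ sumF f + sumF g
  sumF-+ {zero}  f g = sym (+-identityˡ 0#)
  sumF-+ {suc n} f g =
    trans (cong (f zero + g zero +_) (sumF-+ (f ∘ suc) (g ∘ suc))) (+-interchange _ _ _ _)

  sumF-*ˡ : ∀ {n} a (f : Fin n → Carrier) → sumF (λ i → a * f i) ≡ a * sumF f
  sumF-*ˡ {zero}  a f = sym (zeroʳ a)
  sumF-*ˡ {suc n} a f = trans (cong (a * f zero +_) (sumF-*ˡ a (f ∘ suc))) (sym (distribˡ a _ _))

  sumF-*ʳ : ∀ {n} a (f : Fin n → Carrier) → sumF (λ i → f i * a) ≡ sumF f * a
  sumF-*ʳ {zero}  a f = sym (zeroˡ a)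
  sumF-*ʳ {suc n} a f = trans (cong (f zero * a +_) (sumF-*ʳ a (f ∘ suc))) (sym (distribʳ a _ _))

  sumF-neg : ∀ {n} (f : Fin n → Carrier) → sumF (λ i → - f i) ≡ - sumF f
  sumF-neg {zero}  f = sym ε⁻¹≈ε
  sumF-neg {suc n} f = trans (cong (- f zero +_) (sumF-neg (f ∘ suc))) (⁻¹-∙-comm _ _)

  sumF-swap : ∀ {m n} (h : Fin m → Fin n → Carrier) →
    sumF (λ i → sumF (h i)) ≡ sumF (λ j → sumF (λ i → h i j))
  sumF-swap {zero}  {n} h = sym (sumF-zero {n} (λ _ → refl))
  sumF-swap {suc m}     h = trans (cong (sumF (h zero) +_) (sumF-swap (h ∘ suc)))
                                  (sym (sumF-+ (h zero) (λ j → sumF (λ i → h (suc i) j))))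

  sumF-punchIn : ∀ {n} (f : Fin (suc n) → Carrier) j → sumF f ≡ f j + sumF (f ∘ punchIn j)
  sumF-punchIn         f zero    = refl
  sumF-punchIn {suc n} f (suc j) =
    trans (cong (f zero +_) (sumF-punchIn (f ∘ suc) j)) (x+[y+z]≡y+[x+z] _ _ _)

  sumF-combination : ∀ {m n} (c : Fin m → Carrier) (d : Fin m → Fin n → Carrier) (b : Fin n → Carrier) →
    sumF (λ i → c i * sumF (λ j → d i j * b j)) ≡ sumF (λ j → sumF (λ i → c i * d i j) * b j)
  sumF-combination {m} {n} c d b = begin
    sumF (λ i → c i * sumF (λ j → d i j * b j))
      ≡⟨ sumF-cong {m} (λ i → sumF-*ˡ (c i) (λ j → d i j * b j)) ⟨
    sumF (λ i → sumF (λ j → c i * (d i j * b j)))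
      ≡⟨ sumF-swap (λ i j → c i * (d i j * b j)) ⟩
    sumF (λ j → sumF (λ i → c i * (d i j * b j)))
      ≡⟨ sumF-cong {n} (λ j → sumF-cong {m} (λ i → *-assoc (c i) (d i j) (b j))) ⟨
    sumF (λ j → sumF (λ i → c i * d i j * b j))
      ≡⟨ sumF-cong {n} (λ j → sumF-*ʳ (b j) (λ i → c i * d i j)) ⟩
    sumF (λ j → sumF (λ i → c i * d i j) * b j) ∎

module LinearAlgebra (𝔽 : FiniteField) where
  open FiniteField 𝔽
  open Geometry 𝔽
  open FieldProperties 𝔽
  open Sums 𝔽
  open ≡-Reasoning

  infixl 6 _-ᵛ_
  infixl 7 _·ᵛ_

  _·ᵛ_ : Carrier → V6 → V6
  (α ·ᵛ v) k = α * v k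

  _-ᵛ_ : V6 → V6 → V6
  (u -ᵛ v) k = u k + - v k

  Dependent : ∀ {m n} → (Fin m → Fin n → Carrier) → Set
  Dependent {m} w = ∃ λ (c : Fin m → Carrier) →
    (∀ k → sumF (λ i → c i * w i k) ≡ 0#) × ∃ λ i → c i ≢ 0#

  head≡0⇒Dependent : ∀ {m n} (w : Fin (suc m) → Fin n → Carrier) → (∀ k → w zero k ≡ 0#) → Dependent w
  head≡0⇒Dependent {m} w w₀≡0 = (1# ∷ λ _ → 0#) , relation , zero , 1≢0
    where
    relation : ∀ k → 1# * w zero k + sumF (λ i → 0# * w (suc i) k) ≡ 0#
    relation k = trans (cong₂ _+_ (trans (cong (1# *_) (w₀≡0 k)) (zeroʳ 1#)) (sumF-zero {m} (λ _ → zeroˡ _)))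
                       (+-identityˡ 0#)

  -- Gaussian elimination of the k-th coordinate, using the first vector as pivot.
  module Pivot {m n} (w : Fin (suc m) → Fin (suc n) → Carrier) (k : Fin (suc n))
               (w₀ₖ≢0 : w zero k ≢ 0#) where

    ratio : Fin m → Carrier
    ratio i = w (suc i) k * inv (w zero k) w₀ₖ≢0

    cleared : Fin m → Fin (suc n) → Carrier
    cleared i l = w (suc i) l + - (ratio i * w zero l)

    cleared-pivot : ∀ i → cleared i k ≡ 0#
    cleared-pivot i = trans (cong (λ t → w (suc i) k + - t) ratio*pivot) (-‿inverseʳ _)
      where
      ratio*pivot : ratio i * w zero k ≡ w (suc i) k
      ratio*pivot = trans (*-assoc _ _ _) (trans (cong (w (suc i) k *_) (inv-*ˡ _ w₀ₖ≢0)) (*-identityʳ _))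

    extend : (Fin m → Carrier) → Fin (suc m) → Carrier
    extend c = - sumF (λ i → c i * ratio i) ∷ c

    extend-combination : ∀ c l → sumF (λ i → extend c i * w i l) ≡ sumF (λ i → c i * cleared i l)
    extend-combination c l = sym (begin
      sumF (λ i → c i * cleared i l)
        ≡⟨ sumF-cong {m} (λ i → distribˡ (c i) _ _) ⟩
      sumF (λ i → c i * w (suc i) l + c i * - (ratio i * w zero l))
        ≡⟨ sumF-+ {m} _ _ ⟩
      sumF (λ i → c i * w (suc i) l) + sumF (λ i → c i * - (ratio i * w zero l))
        ≡⟨ cong (_ +_) (sumF-cong {m} (λ i → trans (sym (-‿distribʳ-* _ _)) (cong -_ (sym (*-assoc _ _ _))))) ⟩
      sumF (λ i → c i * w (suc i) l) + sumF (λ i → - (c i * ratio i * w zero l))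
        ≡⟨ cong (_ +_) (trans (sumF-neg {m} _) (cong -_ (sumF-*ʳ {m} _ _))) ⟩
      sumF (λ i → c i * w (suc i) l) + - (sumF (λ i → c i * ratio i) * w zero l)
        ≡⟨ +-comm _ _ ⟩
      - (sumF (λ i → c i * ratio i) * w zero l) + sumF (λ i → c i * w (suc i) l)
        ≡⟨ cong (_+ sumF (λ i → c i * w (suc i) l)) (-‿distribˡ-* _ _) ⟩
      sumF (λ i → extend c i * w i l) ∎)

    cleared⇒Dependent : Dependent (λ i l → cleared i (punchIn k l)) → Dependent w
    cleared⇒Dependent (c , relation , i , cᵢ≢0) = extend c , extended-relation , suc i , cᵢ≢0
      where
      extended-relation : ∀ l → sumF (λ i → extend c i * w i l) ≡ 0#
      extended-relation l with k Fin.≟ l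
      ... | yes refl = trans (extend-combination c k)
                             (sumF-zero {m} (λ i → trans (cong (c i *_) (cleared-pivot i)) (zeroʳ _)))
      ... | no k≢l   = trans (extend-combination c l)
                             (subst (λ l′ → sumF (λ i → c i * cleared i l′) ≡ 0#)
                                    (FinP.punchIn-punchOut k≢l) (relation (punchOut k≢l)))

  tooMany⇒Dependent : ∀ n (w : Fin (suc n) → Fin n → Carrier) → Dependent w
  tooMany⇒Dependent zero    w = (λ _ → 1#) , (λ ()) , zero , 1≢0
  tooMany⇒Dependent (suc n) w with FinP.any? (λ k → ¬? (w zero k ≟ 0#))
  ... | yes (k , w₀ₖ≢0) = Pivot.cleared⇒Dependent w k w₀ₖ≢0
                            (tooMany⇒Dependent n (λ i l → Pivot.cleared w k w₀ₖ≢0 i (punchIn k l)))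
  ... | no ∄k           = head≡0⇒Dependent w (λ k → decidable-stable (w zero k ≟ 0#) (∄k ∘ (k ,_)))

  InSpan-resp : ∀ {m} {b : Fam m} {u v} → (∀ k → u k ≡ v k) → InSpan b u → InSpan b v
  InSpan-resp u≡v (c , u≡Σ) = c , λ k → trans (sym (u≡v k)) (u≡Σ k)

  InSpan-zero : ∀ {m} {b : Fam m} {v} → IsZero v → InSpan b v
  InSpan-zero {m} v≡0 = (λ _ → 0#) , λ k → trans (v≡0 k) (sym (sumF-zero {m} (λ _ → zeroˡ _)))

  InSpan-basis : ∀ {m} (b : Fam m) j → InSpan b (b j)
  InSpan-basis {suc m} b zero = (1# ∷ λ _ → 0#) , λ k → sym (begin
    1# * b zero k + sumF (λ i → 0# * b (suc i) k)
      ≡⟨ cong₂ _+_ (*-identityˡ _) (sumF-zero {m} (λ _ → zeroˡ _)) ⟩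
    b zero k + 0#                                 ≡⟨ +-identityʳ _ ⟩
    b zero k                                      ∎)
  InSpan-basis {suc m} b (suc j) with InSpan-basis (b ∘ suc) j
  ... | c , bⱼ≡Σ = (0# ∷ c) , λ k → trans (bⱼ≡Σ k) (sym (0*x+y≡y (b zero k) _))

  InSpan-·ᵛ : ∀ {m} {b : Fam m} {v} α → InSpan b v → InSpan b (α ·ᵛ v)
  InSpan-·ᵛ {m} {b} {v} α (c , v≡Σ) = (λ i → α * c i) , λ k → begin
    α * v k                         ≡⟨ cong (α *_) (v≡Σ k) ⟩
    α * sumF (λ i → c i * b i k)    ≡⟨ sumF-*ˡ α (λ i → c i * b i k) ⟨
    sumF (λ i → α * (c i * b i k))  ≡⟨ sumF-cong {m} (λ i → *-assoc α (c i) (b i k)) ⟨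
    sumF (λ i → α * c i * b i k)    ∎

  InSpan-·ᵛ⁻¹ : ∀ {m} {b : Fam m} {v α} → α ≢ 0# → InSpan b (α ·ᵛ v) → InSpan b v
  InSpan-·ᵛ⁻¹ {v = v} {α} α≢0 αv∈b = InSpan-resp α⁻¹αv≡v (InSpan-·ᵛ (inv α α≢0) αv∈b)
    where
    α⁻¹αv≡v : ∀ k → inv α α≢0 * (α * v k) ≡ v k
    α⁻¹αv≡v k = trans (sym (*-assoc _ α (v k))) (trans (cong (_* v k) (inv-*ˡ α α≢0)) (*-identityˡ _))

  InSpan--ᵛ : ∀ {m} {b : Fam m} {u v} → InSpan b u → InSpan b v → InSpan b (u -ᵛ v)
  InSpan--ᵛ {m} {b} {u} {v} (c , u≡Σ) (d , v≡Σ) = (λ i → c i + - d i) , λ k → sym (begin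
    sumF (λ i → (c i + - d i) * b i k)
      ≡⟨ sumF-cong {m} (λ i → trans (distribʳ _ _ _) (cong (_ +_) (sym (-‿distribˡ-* _ _)))) ⟩
    sumF (λ i → c i * b i k + - (d i * b i k))
      ≡⟨ trans (sumF-+ {m} _ _) (cong (_ +_) (sumF-neg {m} _)) ⟩
    sumF (λ i → c i * b i k) + - sumF (λ i → d i * b i k)
      ≡⟨ cong₂ (λ s t → s + - t) (u≡Σ k) (v≡Σ k) ⟨
    u k + - v k ∎)

  InSpan-∷⁺ : ∀ {m} {z x} {b : Fam m} {α} → InSpan b (x -ᵛ α ·ᵛ z) → InSpan (z ∷ b) x
  InSpan-∷⁺ {α = α} (c , x-αz≡Σ) = (α ∷ c) , λ k → x-y≡z⇒x≡y+z (x-αz≡Σ k)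

  InSpan-∷⁻ : ∀ {m} {z x} {b : Fam m} → InSpan (z ∷ b) x → ∃ λ α → InSpan b (x -ᵛ α ·ᵛ z)
  InSpan-∷⁻ (c , x≡Σ) = c zero , (c ∘ suc) , λ k → x≡y+z⇒x-y≡z (x≡Σ k)

  InSpan-trans : ∀ {m n} {a : Fam m} {b : Fam n} {v} → (∀ i → InSpan b (a i)) → InSpan a v → InSpan b v
  InSpan-trans {m} {n} {a} {b} {v} a⊆b (c , v≡Σ) = (λ j → sumF (λ i → c i * d i j)) , λ k → begin
    v k                                         ≡⟨ v≡Σ k ⟩
    sumF (λ i → c i * a i k)                    ≡⟨ sumF-cong (λ i → cong (c i *_) (proj₂ (a⊆b i) k)) ⟩
    sumF (λ i → c i * sumF (λ j → d i j * b j k)) ≡⟨ sumF-combination c d (λ j → b j k) ⟩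
    sumF (λ j → sumF (λ i → c i * d i j) * b j k) ∎
    where
    d : Fin m → Fin n → Carrier
    d = proj₁ ∘ a⊆b

  InSpan? : ∀ {m} (b : Fam m) v → Dec (InSpan b v)
  InSpan? {zero}  b v = map′ ((λ ()) ,_) proj₂ (FinP.all? (λ k → v k ≟ 0#))
  InSpan? {suc m} b v =
    map′ (InSpan-∷⁺ ∘ proj₂ ∘ satisfied) (λ v∈b → lose (complete _) (proj₂ (InSpan-∷⁻ v∈b)))
         (any? (λ α → InSpan? (b ∘ suc) (v -ᵛ α ·ᵛ b zero)) elements)

  InSpan⇒Dependent : ∀ {m} {b : Fam m} (w : Fam (suc m)) → (∀ i → InSpan b (w i)) → Dependent w
  InSpan⇒Dependent {m} {b} w w⊆b =
    let c , relation , nontrivial = tooMany⇒Dependent m (proj₁ ∘ w⊆b)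
        _ , combination≡Σ = InSpan-trans {a = w} {b} {λ k → sumF (λ i → c i * w i k)} w⊆b (c , λ _ → refl)
        combination≡0 : ∀ k → sumF (λ i → c i * w i k) ≡ 0#
        combination≡0 k = trans (combination≡Σ k)
                                (sumF-zero {m} (λ j → trans (cong (_* b j k) (relation j)) (zeroˡ _)))
    in c , combination≡0 , nontrivial

  relation-tail : ∀ {m} {z} {b : Fam m} (c : Fin (suc m) → Carrier) → c zero ≡ 0# →
    (∀ k → sumF (λ i → c i * (z ∷ b) i k) ≡ 0#) → ∀ k → sumF (λ i → c (suc i) * b i k) ≡ 0#
  relation-tail {z = z} {b} c c₀≡0 relation k = begin
    tail                 ≡⟨ 0*x+y≡y (z k) tail ⟨
    0# * z k + tail      ≡⟨ cong (λ c₀ → c₀ * z k + tail) c₀≡0 ⟨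
    c zero * z k + tail  ≡⟨ relation k ⟩
    0#                   ∎
    where
    tail : Carrier
    tail = sumF (λ i → c (suc i) * b i k)

  ∷-relation : ∀ {m} {z} {b : Fam m} → LinIndep b → (c : Fin (suc m) → Carrier) →
    (∀ k → sumF (λ i → c i * (z ∷ b) i k) ≡ 0#) → (∀ i → c i ≡ 0#) ⊎ InSpan b z
  ∷-relation {m} {z} {b} b-indep c relation with c zero ≟ 0#
  ... | yes c₀≡0 = inj₁ λ { zero → c₀≡0 ; (suc i) → b-indep (c ∘ suc) (relation-tail c c₀≡0 relation) i }
  ... | no c₀≢0  = inj₂ (InSpan-·ᵛ⁻¹ c₀≢0 ((λ i → - c (suc i)) , c₀z≡Σ))
    where
    c₀z≡Σ : ∀ k → c zero * z k ≡ sumF (λ i → - c (suc i) * b i k)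
    c₀z≡Σ k = begin
      c zero * z k                        ≡⟨ inverseˡ-unique _ _ (relation k) ⟩
      - sumF (λ i → c (suc i) * b i k)    ≡⟨ sumF-neg {m} _ ⟨
      sumF (λ i → - (c (suc i) * b i k))  ≡⟨ sumF-cong {m} (λ i → -‿distribˡ-* _ _) ⟩
      sumF (λ i → - c (suc i) * b i k)    ∎

  LinIndep-∷ : ∀ {m} {z} {b : Fam m} → LinIndep b → ¬ InSpan b z → LinIndep (z ∷ b)
  LinIndep-∷ b-indep z∉b c relation with ∷-relation b-indep c relation
  ... | inj₁ c≡0 = c≡0
  ... | inj₂ z∈b = ⊥-elim (z∉b z∈b)

  -- pair u w and u ∷ w ∷ [] agree on both indices, so LinIndep unfolds to the same type for both.
  LinIndep-pair : ∀ {u w} → ¬ IsZero w → ¬ InSpan (w ∷ []) u → LinIndep (pair u w)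
  LinIndep-pair {u} {w} w≢0 =
    LinIndep-∷ {z = u} {b = w ∷ []} (LinIndep-∷ {z = w} {b = []} (λ _ _ ()) (w≢0 ∘ proj₂))

  dependent-∷⇒InSpan : ∀ {m} {z} {b : Fam m} → LinIndep b → Dependent (z ∷ b) → InSpan b z
  dependent-∷⇒InSpan b-indep (c , relation , i , cᵢ≢0) with ∷-relation b-indep c relation
  ... | inj₁ c≡0 = ⊥-elim (cᵢ≢0 (c≡0 i))
  ... | inj₂ z∈b = z∈b

  SameSpace-sym : ∀ {m n} {a : Fam m} {b : Fam n} → SameSpace a b → SameSpace b a
  SameSpace-sym a≈b v = swap (a≈b v)

  SameSpace-trans : ∀ {l m n} {a : Fam l} {b : Fam m} {c : Fam n} →
    SameSpace a b → SameSpace b c → SameSpace a c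
  SameSpace-trans a≈b b≈c v = proj₁ (b≈c v) ∘ proj₁ (a≈b v) , proj₂ (a≈b v) ∘ proj₂ (b≈c v)

  LinIndep⊆⇒SameSpace : ∀ {m} {a b : Fam m} → LinIndep a → (∀ i → InSpan b (a i)) → SameSpace a b
  LinIndep⊆⇒SameSpace {a = a} {b} a-indep a⊆b v = InSpan-trans a⊆b , b⊆a
    where
    b⊆a : InSpan b v → InSpan a v
    b⊆a v∈b = dependent-∷⇒InSpan a-indep (InSpan⇒Dependent (v ∷ a) λ { zero → v∈b ; (suc i) → a⊆b i })

  ¬SameSpace⇒∃∉ : ∀ {m} {a b : Fam m} → LinIndep a → ¬ SameSpace a b → ∃ λ i → ¬ InSpan b (a i)
  ¬SameSpace⇒∃∉ {m} {a} {b} a-indep a≉b =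
    FinP.¬∀⟶∃¬ m _ (λ i → InSpan? b (a i)) (a≉b ∘ LinIndep⊆⇒SameSpace a-indep)

  meetInLine : ∀ {σ τ : Fam 3} {u w} → LinIndep (pair u w) →
    InSpan σ u → InSpan τ u → InSpan σ w → InSpan τ w → ¬ SameSpace σ τ → MeetInLine σ τ
  meetInLine {σ} {τ} {u} {w} uw-indep u∈σ u∈τ w∈σ w∈τ σ≉τ =
    u , w , uw-indep , u∈σ , u∈τ , w∈σ , w∈τ , σ∩τ⊆uw
    where
    σ∩τ⊆uw : ∀ z → InSpan σ z → InSpan τ z → InSpan (pair u w) z
    σ∩τ⊆uw z z∈σ z∈τ = decidable-stable (InSpan? (pair u w) z) λ z∉uw →
      σ≉τ (SameSpace-trans {a = σ} {zuw} {τ} (SameSpace-sym {a = zuw} {σ} (zuw≈ σ z∈σ u∈σ w∈σ z∉uw))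
                                             (zuw≈ τ z∈τ u∈τ w∈τ z∉uw))
      where
      zuw : Fam 3
      zuw = z ∷ pair u w
      zuw≈ : ∀ ρ → InSpan ρ z → InSpan ρ u → InSpan ρ w → ¬ InSpan (pair u w) z → SameSpace zuw ρ
      zuw≈ ρ z∈ρ u∈ρ w∈ρ z∉uw =
        LinIndep⊆⇒SameSpace {a = zuw} {ρ} (LinIndep-∷ {z = z} {b = pair u w} uw-indep z∉uw)
          λ { zero → z∈ρ ; (suc zero) → u∈ρ ; (suc (suc zero)) → w∈ρ }

module SymplecticForm (𝔽 : FiniteField) where
  open FiniteField 𝔽
  open Geometry 𝔽
  open FieldProperties 𝔽
  open Sums 𝔽
  open ≡-Reasoning
  open import Algebra.Solver.Ring.NaturalCoefficients.Default commutativeSemiring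

  ω : V6 → V6 → Carrier
  ω u v = u (# 0) * v (# 3) + u (# 1) * v (# 4) + u (# 2) * v (# 5)

  B≡ω-ω : ∀ u v → B u v ≡ ω u v + - ω v u
  B≡ω-ω u v = cong (λ t → ω u v + - t) (cong₂ _+_ (cong₂ _+_ (*-comm _ _) (*-comm _ _)) (*-comm _ _))

  B-antisym : ∀ u v → B u v ≡ - B v u
  B-antisym u v = begin
    B u v                ≡⟨ B≡ω-ω u v ⟩
    ω u v + - ω v u      ≡⟨ ⁻¹-anti-homo‿- (ω v u) (ω u v) ⟨
    - (ω v u + - ω u v)  ≡⟨ cong -_ (B≡ω-ω v u) ⟨
    - B v u              ∎

  B-self : ∀ v → B v v ≡ 0#
  B-self v = trans (B≡ω-ω v v) (-‿inverseʳ (ω v v))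

  dual : V6 → V6
  dual u = - u (# 3) ∷ - u (# 4) ∷ - u (# 5) ∷ u (# 0) ∷ u (# 1) ∷ u (# 2) ∷ []

  B-dual : ∀ u v → B u v ≡ sumF (λ k → dual u k * v k)
  B-dual u v = begin
    X₀ + X₁ + X₂ + - (Y₀ + Y₁ + Y₂)
      ≡⟨ cong (X₀ + X₁ + X₂ +_) (trans (cong (_+ - Y₂) (⁻¹-∙-comm Y₀ Y₁))
                                       (⁻¹-∙-comm (Y₀ + Y₁) Y₂)) ⟨
    X₀ + X₁ + X₂ + (- Y₀ + - Y₁ + - Y₂)
      ≡⟨ solve 6 (λ a b c x y z → a :+ b :+ c :+ (x :+ y :+ z) := x :+ (y :+ (z :+ (a :+ (b :+ (c :+ con 0))))))
               refl X₀ X₁ X₂ (- Y₀) (- Y₁) (- Y₂) ⟩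
    - Y₀ + (- Y₁ + (- Y₂ + X))
      ≡⟨ cong₂ _+_ (-‿distribˡ-* _ _) (cong₂ _+_ (-‿distribˡ-* _ _) (cong (_+ X) (-‿distribˡ-* _ _))) ⟩
    sumF (λ k → dual u k * v k) ∎
    where
    X₀ X₁ X₂ Y₀ Y₁ Y₂ X : Carrier
    X₀ = u (# 0) * v (# 3)
    X₁ = u (# 1) * v (# 4)
    X₂ = u (# 2) * v (# 5)
    Y₀ = u (# 3) * v (# 0)
    Y₁ = u (# 4) * v (# 1)
    Y₂ = u (# 5) * v (# 2)
    X  = X₀ + (X₁ + (X₂ + 0#))

  B-congʳ : ∀ u {v v′} → (∀ k → v k ≡ v′ k) → B u v ≡ B u v′
  B-congʳ u {v} {v′} v≡v′ =
    trans (B-dual u v) (trans (sumF-cong (λ k → cong (dual u k *_) (v≡v′ k))) (sym (B-dual u v′)))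

  B-zeroʳ : ∀ u {v} → IsZero v → B u v ≡ 0#
  B-zeroʳ u {v} v≡0 = trans (B-dual u v) (sumF-zero (λ k → trans (cong (dual u k *_) (v≡0 k)) (zeroʳ _)))

  B-linearʳ : ∀ {m} u (c : Fin m → Carrier) (w : Fam m) →
    B u (λ k → sumF (λ i → c i * w i k)) ≡ sumF (λ i → c i * B u (w i))
  B-linearʳ {m} u c w = begin
    B u (λ k → sumF (λ i → c i * w i k))
      ≡⟨ B-dual u (λ k → sumF (λ i → c i * w i k)) ⟩
    sumF (λ k → dual u k * sumF (λ i → c i * w i k))
      ≡⟨ sumF-cong {6} (λ k → *-comm (dual u k) (sumF (λ i → c i * w i k))) ⟩
    sumF (λ k → sumF (λ i → c i * w i k) * dual u k)
      ≡⟨ sumF-combination c w (dual u) ⟨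
    sumF (λ i → c i * sumF (λ k → w i k * dual u k))
      ≡⟨ sumF-cong {m} (λ i → cong (c i *_) (B-dual′ i)) ⟩
    sumF (λ i → c i * B u (w i)) ∎
    where
    B-dual′ : ∀ i → sumF (λ k → w i k * dual u k) ≡ B u (w i)
    B-dual′ i = trans (sumF-cong {6} (λ k → *-comm (w i k) (dual u k))) (sym (B-dual u (w i)))

  ⊥-InSpan : ∀ {m} {b : Fam m} {u v} → (∀ i → B u (b i) ≡ 0#) → InSpan b v → B u v ≡ 0#
  ⊥-InSpan {m} {b} {u} {v} u⊥b (c , v≡Σ) = begin
    B u v                                 ≡⟨ B-congʳ u v≡Σ ⟩
    B u (λ k → sumF (λ i → c i * b i k))  ≡⟨ B-linearʳ u c b ⟩
    sumF (λ i → c i * B u (b i))          ≡⟨ sumF-zero {m} (λ i → trans (cong (c i *_) (u⊥b i)) (zeroʳ _)) ⟩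
    0#                                    ∎

  TotIso-InSpan : ∀ {m} {b : Fam m} {x y} → TotIso b → InSpan b x → InSpan b y → B x y ≡ 0#
  TotIso-InSpan {b = b} {x} {y} b-iso x∈b y∈b = ⊥-InSpan {b = b} {x} {y} x⊥b y∈b
    where
    x⊥b : ∀ j → B x (b j) ≡ 0#
    x⊥b j = trans (B-antisym x (b j)) (trans (cong -_ (⊥-InSpan {b = b} {b j} {x} (b-iso j) x∈b)) ε⁻¹≈ε)

  unit-diagonal : ∀ j → unit j j ≡ 1#
  unit-diagonal j with toℕ j ℕ.≟ toℕ j
  ... | yes _  = refl
  ... | no j≢j = ⊥-elim (j≢j refl)

  unit-offDiagonal : ∀ {j k} → j ≢ k → unit j k ≡ 0#
  unit-offDiagonal {j} {k} j≢k with toℕ j ℕ.≟ toℕ k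
  ... | yes j≡k = ⊥-elim (j≢k (FinP.toℕ-injective j≡k))
  ... | no _    = refl

  sumF-*unit : ∀ (f : V6) j → sumF (λ k → f k * unit j k) ≡ f j
  sumF-*unit f j = begin
    sumF (λ k → f k * unit j k)
      ≡⟨ sumF-punchIn (λ k → f k * unit j k) j ⟩
    f j * unit j j + sumF (λ k → f (punchIn j k) * unit j (punchIn j k))
      ≡⟨ cong₂ _+_ (cong (f j *_) (unit-diagonal j)) (sumF-zero off-diagonal) ⟩
    f j * 1# + 0#
      ≡⟨ trans (+-identityʳ _) (*-identityʳ _) ⟩
    f j ∎
    where
    off-diagonal : ∀ k → f (punchIn j k) * unit j (punchIn j k) ≡ 0#
    off-diagonal k = trans (cong (_ *_) (unit-offDiagonal (FinP.punchInᵢ≢i j k ∘ sym))) (zeroʳ _)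

  B-unit : ∀ v j → B v (unit j) ≡ dual v j
  B-unit v j = trans (B-dual v (unit j)) (sumF-*unit (dual v) j)

  partner : Fin 6 → Fin 6
  partner = # 3 ∷ # 4 ∷ # 5 ∷ # 0 ∷ # 1 ∷ # 2 ∷ []

  dual-partner : ∀ v k → v k ≢ 0# → dual v (partner k) ≢ 0#
  dual-partner v zero                               vₖ≢0 = vₖ≢0
  dual-partner v (suc zero)                         vₖ≢0 = vₖ≢0
  dual-partner v (suc (suc zero))                   vₖ≢0 = vₖ≢0
  dual-partner v (suc (suc (suc zero)))             vₖ≢0 = vₖ≢0 ∘ -x≡0⇒x≡0
  dual-partner v (suc (suc (suc (suc zero))))       vₖ≢0 = vₖ≢0 ∘ -x≡0⇒x≡0
  dual-partner v (suc (suc (suc (suc (suc zero))))) vₖ≢0 = vₖ≢0 ∘ -x≡0⇒x≡0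

  B-nondegenerate : ∀ v → ¬ IsZero v → ∃ λ u → B v u ≢ 0#
  B-nondegenerate v v≢0 with FinP.¬∀⟶∃¬ 6 _ (λ k → v k ≟ 0#) v≢0
  ... | k , vₖ≢0 = unit (partner k) , dual-partner v k vₖ≢0 ∘ trans (sym (B-unit v (partner k)))

module PolarSpace (𝔽 : FiniteField) where
  open FiniteField 𝔽
  open Geometry 𝔽
  open FieldProperties 𝔽
  open Sums 𝔽 using (sumF-zero)
  open LinearAlgebra 𝔽
  open SymplecticForm 𝔽
  open ≡-Reasoning

  firstNonzero : ∀ {n} (v : Fin n → Carrier) → ¬ (∀ k → v k ≡ 0#) →
    ∃ λ i → v i ≢ 0# × (∀ j → toℕ j ℕ.< toℕ i → v j ≡ 0#)
  firstNonzero {zero}  v v≢0 = ⊥-elim (v≢0 λ ())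
  firstNonzero {suc n} v v≢0 with v zero ≟ 0#
  ... | no v₀≢0  = zero , v₀≢0 , λ _ ()
  ... | yes v₀≡0
    with firstNonzero (v ∘ suc) (λ v∘suc≡0 → v≢0 λ { zero → v₀≡0 ; (suc k) → v∘suc≡0 k })
  ...   | i , vᵢ≢0 , below = suc i , vᵢ≢0 , λ { zero _ → v₀≡0 ; (suc j) (s≤s j<i) → below j j<i }

  normalise : ∀ v → ¬ IsZero v → ∃ λ α → Normalized (α ·ᵛ v)
  normalise v v≢0 with firstNonzero v v≢0
  ... | i , vᵢ≢0 , below = α , i , inv-*ˡ (v i) vᵢ≢0 , λ j j<i → trans (cong (α *_) (below j j<i)) (zeroʳ α)
    where
    α : Carrier
    α = inv (v i) vᵢ≢0

  Normalized⇒¬IsZero : ∀ {p} → Normalized p → ¬ IsZero p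
  Normalized⇒¬IsZero (i , pᵢ≡1 , _) p≡0 = 1≢0 (trans (sym pᵢ≡1) (p≡0 i))

  Dependent-dropNonOrthogonal : ∀ {m} {P u} {b : Fam m} → B P u ≢ 0# → (∀ j → B P (b j) ≡ 0#) →
    Dependent (u ∷ b) → Dependent b
  Dependent-dropNonOrthogonal {m} {P} {u} {b} P⊥̸u P⊥b (c , relation , i , cᵢ≢0) =
    c ∘ suc , relation-tail c c₀≡0 relation , nontrivial i cᵢ≢0
    where
    c₀≡0 : c zero ≡ 0#
    c₀≡0 = x*y≡0⇒x≡0 P⊥̸u (begin
      c zero * B P u                              ≡⟨ +-identityʳ _ ⟨
      c zero * B P u + 0#                         ≡⟨ cong (c zero * B P u +_) (sumF-zero {m} tail⊥) ⟨
      sumF (λ j → c j * B P ((u ∷ b) j))          ≡⟨ B-linearʳ P c (u ∷ b) ⟨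
      B P (λ k → sumF (λ j → c j * (u ∷ b) j k))  ≡⟨ B-zeroʳ P relation ⟩
      0#                                          ∎)
      where
      tail⊥ : ∀ j → c (suc j) * B P (b j) ≡ 0#
      tail⊥ j = trans (cong (c (suc j) *_) (P⊥b j)) (zeroʳ _)

    nontrivial : ∀ j → c j ≢ 0# → ∃ λ j′ → c (suc j′) ≢ 0#
    nontrivial zero    c₀≢0 = ⊥-elim (c₀≢0 c₀≡0)
    nontrivial (suc j) cⱼ≢0 = j , cⱼ≢0

  ⊥-decomposition : ∀ {P} {S : Fam 4} → ¬ IsZero P → LinIndep S → (∀ i → B P (S i) ≡ 0#) →
    ¬ InSpan S P → ∀ x → B P x ≡ 0# → InSpan (P ∷ S) x
  ⊥-decomposition {P} {S} P≢0 S-indep P⊥S P∉S x P⊥x =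
    let u , P⊥̸u = B-nondegenerate P P≢0
    in dependent-∷⇒InSpan {z = x} {b = P ∷ S} (LinIndep-∷ {z = P} {b = S} S-indep P∉S)
         (Dependent-dropNonOrthogonal {P = P} {u} {x ∷ P ∷ S} P⊥̸u P⊥
           (tooMany⇒Dependent 6 (u ∷ x ∷ P ∷ S)))
    where
    P⊥ : ∀ j → B P ((x ∷ P ∷ S) j) ≡ 0#
    P⊥ zero          = P⊥x
    P⊥ (suc zero)    = B-self P
    P⊥ (suc (suc j)) = P⊥S j

  -- Opaque, so that the main proof does not unfold these existence proofs while type checking.
  opaque
    pointOfΠ₂ : ∀ {n} {σ : Fam n} {v} → ¬ IsZero v → InSpan Π₂ v → InSpan σ v →
      ∃ λ P → PointOfΠ₂ P × InSpan σ P
    pointOfΠ₂ {σ = σ} {v} v≢0 v∈Π₂ v∈σ with normalise v v≢0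
    ... | α , αv-normalized =
      α ·ᵛ v , (αv-normalized , InSpan-·ᵛ {b = Π₂} α v∈Π₂) , InSpan-·ᵛ {b = σ} α v∈σ

    plane∩Σ⊈Π₂ : ∀ {σ : Fam 3} {P} {S : Fam 4} → IsPlaneW σ → ¬ SameSpace σ Π₂ →
      InSpan σ P → InSpan Π₂ P → ¬ IsZero P → LinIndep S → (∀ i → B P (S i) ≡ 0#) → ¬ InSpan S P →
      ∃ λ m → InSpan σ m × InSpan S m × ¬ InSpan Π₂ m
    plane∩Σ⊈Π₂ {σ} {P} {S} (σ-indep , σ-iso) σ≉Π₂ P∈σ P∈Π₂ P≢0 S-indep P⊥S P∉S =
      let i , σᵢ∉Π₂ = ¬SameSpace⇒∃∉ {a = σ} {Π₂} σ-indep σ≉Π₂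
          σᵢ∈σ      = InSpan-basis σ i
          P⊥σᵢ      = TotIso-InSpan {b = σ} σ-iso P∈σ σᵢ∈σ
          α , m∈S   = InSpan-∷⁻ {z = P} {b = S} (⊥-decomposition {P} {S} P≢0 S-indep P⊥S P∉S (σ i) P⊥σᵢ)
          P∷Π₂⊆Π₂ : ∀ j → InSpan Π₂ ((P ∷ Π₂) j)
          P∷Π₂⊆Π₂ = λ { zero → P∈Π₂ ; (suc j) → InSpan-basis Π₂ j }
          m∉Π₂ : ¬ InSpan Π₂ (σ i -ᵛ α ·ᵛ P)
          m∉Π₂ m∈Π₂ = σᵢ∉Π₂ (InSpan-trans {a = P ∷ Π₂} {Π₂} P∷Π₂⊆Π₂ (InSpan-∷⁺ {b = Π₂} m∈Π₂))
      in σ i -ᵛ α ·ᵛ P , InSpan--ᵛ {b = σ} σᵢ∈σ (InSpan-·ᵛ {b = σ} α P∈σ) , m∈S , m∉Π₂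

mainTheorem16 : (𝔽 : FiniteField) → let open Geometry 𝔽 in
    (Sg : V6 → Fam 4) (Sp : V6 → List (Fam 2)) →
    (∀ p → PointOfΠ₂ p → ValidChoice p (Sg p) (Sp p)) →
    (σ : Fam 3) → IsPlaneW σ → ¬ InX Sg Sp σ →
    (∀ v → InSpan σ v → InSpan Π₁ v → IsZero v) →
    (∃ λ v → ¬ IsZero v × InSpan σ v × InSpan Π₂ v) →
    ∃ λ τ → InX Sg Sp τ × MeetInLine σ τ
mainTheorem16 𝔽 Sg Sp valid σ σ-plane σ∉𝒳 σ∩Π₁≡0 (v , v≢0 , v∈σ , v∈Π₂) =
  let open Geometry 𝔽
      open LinearAlgebra 𝔽
      open PolarSpace 𝔽
      P , P-point@(P-normalized , P∈Π₂) , P∈σ = pointOfΠ₂ {σ = σ} v≢0 v∈Π₂ v∈σ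
      P≢0 : ¬ IsZero P
      P≢0 = Normalized⇒¬IsZero P-normalized
      S-indep , P⊥S , P∉S , (_ , _ , F-covers) , _ = valid P P-point
      m , m∈σ , m∈S , m∉Π₂ =
        plane∩Σ⊈Π₂ {σ} {P} {Sg P} σ-plane (σ∉𝒳 ∘ inj₁) P∈σ P∈Π₂ P≢0 S-indep P⊥S P∉S
      m≢0 : ¬ IsZero m
      m≢0 = m∉Π₂ ∘ InSpan-zero {b = Π₂}
      ℓ , ℓ∈F , m∈ℓ = find (F-covers m m≢0 m∈S)
      ℓ≉r : ¬ IsMeet ℓ (Sg P) Π₁
      ℓ≉r r = m≢0 (σ∩Π₁≡0 m m∈σ (proj₂ (proj₁ (r m) m∈ℓ)))
      ℓ≉t : ¬ IsMeet ℓ (Sg P) Π₂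
      ℓ≉t t = m∉Π₂ (proj₂ (proj₁ (t m) m∈ℓ))
      τ : Fam 3
      τ = triple P (ℓ zero) (ℓ (suc zero))
      m∈τ : InSpan τ m
      m∈τ = InSpan-trans {a = ℓ} {τ} (λ { zero → InSpan-basis τ (# 1) ; (suc zero) → InSpan-basis τ (# 2) })
                                     m∈ℓ
      m∉⟨P⟩ : ¬ InSpan (P ∷ []) m
      m∉⟨P⟩ = m∉Π₂ ∘ InSpan-trans {a = P ∷ []} {Π₂} (λ { zero → P∈Π₂ })
  in τ , inj₂ (P , P-point , ℓ , ℓ∈F , ℓ≉r , ℓ≉t , λ _ → id , id)
       , meetInLine {σ} {τ} (LinIndep-pair {m} {P} P≢0 m∉⟨P⟩) m∈σ m∈τ P∈σ (InSpan-basis τ zero)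
                    (λ σ≈τ → σ∉𝒳 (inj₂ (P , P-point , ℓ , ℓ∈F , ℓ≉r , ℓ≉t , σ≈τ)))
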